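{- Let $a$ be an odd positive integer and let $k,m\ge 0$ be integers with $k\equiv m\pmod 2$. Then for every positive integer $n$, $$t(a,3a,4k+2,4m+2;n)=\frac23\Big(N\big(a,3a,4k+2,4m+2;\,8n+4m+4k+4a+4\big)-N\big(a,3a,4k+2,4m+2;\,2n+m+k+a+1\big)\Big).$$
   Context: For positive integers $a,b,c,d$ and an integer $n\ge 0$, $N(a,b,c,d;n)$ denotes the number of $(x,y,z,w)\in\mathbb Z^4$ with $n=ax^2+by^2+cz^2+dw^2$, and $t(a,b,c,d;n)$ denotes the number of $(x,y,z,w)\in\mathbb Z^4$ with $n=a\frac{x(x-1)}2+b\frac{y(y-1)}2+c\frac{z(z-1)}2+d\frac{w(w-1)}2$. -}

module Defs where

open import Data.Nat using (ℕ; zero; suc)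
open import Data.Integer using (ℤ; +_; -[1+_]; _+_; _*_; _-_)
open import Data.Integer.DivMod using (_/ℕ_)
open import Data.List using (List; []; _∷_; map; concatMap; upTo)
open import Data.Nat.ListAction using (sum)
open import Relation.Nullary.Decidable using (⌊_⌋)
open import Data.Integer using (_≟_)
open import Data.Bool using (if_then_else_)

range : ℕ → List ℤ
range B = map (λ i → + i) (upTo (suc B)) Data.List.++ map (λ i → -[1+ i ]) (upTo B)

count4 : ℕ → (ℤ → ℤ → ℤ → ℤ → ℤ) → ℤ → ℕ
count4 B Q n =
  sum (concatMap (λ x → concatMap (λ y → concatMap (λ z → map (λ w →
    if ⌊ Q x y z w ≟ n ⌋ then 1 else 0) (range B)) (range B)) (range B)) (range B))

-- triangular-type number x(x-1)/2 (exact division: x(x-1) is even)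
tri : ℤ → ℤ
tri x = (x * (x - + 1)) /ℕ 2

-- All solutions satisfy |x|,|y|,|z|,|w| ≤ n (coefficients are ≥ 1),
-- so counting over the box [-n,n]^4 counts all of ℤ^4 solutions.
N : ℕ → ℕ → ℕ → ℕ → ℕ → ℕ
N a b c d n = count4 n
  (λ x y z w → + a * (x * x) + + b * (y * y) + + c * (z * z) + + d * (w * w)) (+ n)

-- t(a,b,c,d;n) = #{(x,y,z,w) ∈ ℤ^4 : n = a x(x-1)/2 + ... + d w(w-1)/2}.
-- x(x-1)/2 ≤ n forces -n ≤ x ≤ n+1, so the box [-(n+1), n+1]^4 suffices.
t : ℕ → ℕ → ℕ → ℕ → ℕ → ℕ
t a b c d n = count4 (suc n)
  (λ x y z w → + a * tri x + + b * tri y + + c * tri z + + d * tri w) (+ n)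

{-# OPTIONS --safe #-}
module Submission where

-- Write Q = a x² + 3a y² + c z² + d w² with c = 4k + 2, d = 4m + 2, and M = 8n + 4(a + k + m + 1).
-- Modulo 2 a solution of Q = M has x ≡ y, so x = y + 2j and a x² + 3a y² = 4a (j² + jy + y²)
-- is four times an Eisenstein norm; modulo 4 and 8 it then has z ≡ w ≡ j² + jy + y² (mod 2).
-- Sorting solutions by the parities of (j, y): the class (0,0) consists of the all-even
-- solutions, counted by N(M/4) after halving; the classes (0,1) and (1,1) together are the
-- all-odd solutions, which x ↦ 2x - 1 matches with the solutions counted by t(n).  The
-- rotation (j, y) ↦ (y, -(j + y)) of order 3 preserves the norm and permutes the classes
-- (1,0) → (0,1) → (1,1) cyclically, so these three classes have a common size W.  Hence
-- N(M) = N(M/4) + 3W and t(n) = 2W.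

open import Data.Nat as ℕ using (ℕ)
open import Data.Parity using (1ℙ)
open import Relation.Binary.PropositionalEquality using (_≡_)

module Sums where

  open import Data.Bool using (Bool; true; false; if_then_else_)
  open import Data.Bool.Properties using (T-≡)
  open import Data.Empty using (⊥-elim)
  open import Data.List using (List; []; _∷_; map; filter)
  open import Data.List.Properties using (map-∘; filter-accept; filter-reject)
  open import Data.List.Membership.Propositional using (_∈_)
  open import Data.List.Membership.Propositional.Properties using (∈-map⁺; ∈-filter⁺; ∈-filter⁻)
  open import Data.List.Membership.Propositional.Properties.WithK using (unique∧set⇒bag)
  open import Data.List.Relation.Binary.BagAndSetEquality using (∼bag⇒↭)
  import Data.List.Relation.Binary.Permutation.Propositional.Properties as ↭
  open import Data.List.Relation.Unary.Unique.Propositional using (Unique)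
  import Data.List.Relation.Unary.Unique.Propositional.Properties as Unique
  open import Data.Nat using (ℕ; _+_; _≟_)
  open import Data.Nat.ListAction using (sum)
  open import Data.Nat.ListAction.Properties using (sum-↭)
  import Data.Nat.Properties as ℕ
  open import Algebra.Properties.CommutativeSemigroup ℕ.+-commutativeSemigroup using (interchange)
  open import Data.Product using (∃; _×_; _,_)
  open import Function using (_∘_; _⇔_; Injective; mk⇔; Equivalence)
  open import Relation.Nullary using (Dec; yes; no; ¬?)
  open import Relation.Nullary.Decidable using (⌊_⌋; toWitness)
  open import Relation.Binary.PropositionalEquality

  private variable
    A B : Set

  sumOver : List A → (A → ℕ) → ℕ
  sumOver xs f = sum (map f xs)

  sumOver-cong : ∀ (xs : List A) {f g : A → ℕ} → (∀ x → f x ≡ g x) → sumOver xs f ≡ sumOver xs g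
  sumOver-cong []       _   = refl
  sumOver-cong (x ∷ xs) f≗g = cong₂ _+_ (f≗g x) (sumOver-cong xs f≗g)

  sumOver-+ : ∀ (xs : List A) (f g : A → ℕ) →
              sumOver xs (λ x → f x + g x) ≡ sumOver xs f + sumOver xs g
  sumOver-+ []       f g = refl
  sumOver-+ (x ∷ xs) f g =
    trans (cong (f x + g x +_) (sumOver-+ xs f g)) (interchange (f x) (g x) _ _)

  sumOver-filter-nonzero : ∀ (f : A → ℕ) xs → sumOver (filter (λ x → ¬? (f x ≟ 0)) xs) f ≡ sumOver xs f
  sumOver-filter-nonzero f [] = refl
  sumOver-filter-nonzero f (x ∷ xs) with f x ≟ 0
  ... | yes fx≡0 rewrite filter-reject (λ x → ¬? (f x ≟ 0)) {xs = xs} (λ fx≢0 → fx≢0 fx≡0) | fx≡0 =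
    sumOver-filter-nonzero f xs
  ... | no fx≢0 rewrite filter-accept (λ x → ¬? (f x ≟ 0)) {xs = xs} fx≢0 =
    cong (f x +_) (sumOver-filter-nonzero f xs)

  sumOver-support : ∀ {f : A → ℕ} {xs ys} → Unique xs → Unique ys →
                    (∀ {x} → f x ≢ 0 → x ∈ xs ⇔ x ∈ ys) → sumOver xs f ≡ sumOver ys f
  sumOver-support {f = f} {xs} {ys} !xs !ys same-support = begin
    sumOver xs f              ≡⟨ sumOver-filter-nonzero f xs ⟨
    sumOver (filter P? xs) f  ≡⟨ sum-↭ (↭.map⁺ f (∼bag⇒↭ (unique∧set⇒bag (Unique.filter⁺ P? !xs)
                                                                     (Unique.filter⁺ P? !ys) same))) ⟩
    sumOver (filter P? ys) f  ≡⟨ sumOver-filter-nonzero f ys ⟩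
    sumOver ys f              ∎
    where
    open ≡-Reasoning
    P? = λ x → ¬? (f x ≟ 0)
    same : ∀ {x} → x ∈ filter P? xs ⇔ x ∈ filter P? ys
    same = mk⇔
      (λ x∈ → let x∈xs , fx≢0 = ∈-filter⁻ P? x∈ in ∈-filter⁺ P? (Equivalence.to (same-support fx≢0) x∈xs) fx≢0)
      (λ x∈ → let x∈ys , fx≢0 = ∈-filter⁻ P? x∈ in ∈-filter⁺ P? (Equivalence.from (same-support fx≢0) x∈ys) fx≢0)

  sumOver-reindex : ∀ {xs : List A} {ys : List B} (h : A → B) {g : B → ℕ} {f : A → ℕ} →
                    Injective _≡_ _≡_ h → Unique xs → Unique ys → (∀ x → g (h x) ≡ f x) →
                    (∀ {y} → g y ≢ 0 → y ∈ ys) → (∀ {x} → f x ≢ 0 → x ∈ xs) →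
                    (∀ {y} → g y ≢ 0 → ∃ λ x → h x ≡ y) →
                    sumOver ys g ≡ sumOver xs f
  sumOver-reindex {xs = xs} {ys} h {g} {f} h-injective !xs !ys g∘h≗f supp-g supp-f supp-g⊆image = begin
    sumOver ys g          ≡⟨ sumOver-support !ys (Unique.map⁺ h-injective !xs) same-support ⟩
    sumOver (map h xs) g  ≡⟨ cong sum (map-∘ xs) ⟨
    sumOver xs (g ∘ h)    ≡⟨ sumOver-cong xs g∘h≗f ⟩
    sumOver xs f          ∎
    where
    open ≡-Reasoning
    same-support : ∀ {y} → g y ≢ 0 → y ∈ ys ⇔ y ∈ map h xs
    same-support gy≢0 with supp-g⊆image gy≢0
    ... | x , refl = mk⇔ (λ _ → ∈-map⁺ h (supp-f (subst (_≢ 0) (g∘h≗f x) gy≢0))) (λ _ → supp-g gy≢0)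

  𝟙 : ∀ {P : Set} → Dec P → ℕ
  𝟙 p? = if ⌊ p? ⌋ then 1 else 0

  𝟙≢0 : ∀ {P : Set} (p? : Dec P) → 𝟙 p? ≢ 0 → P
  𝟙≢0 (yes p) _   = p
  𝟙≢0 (no _)  0≢0 = ⊥-elim (0≢0 refl)

  𝟙-⇔ : ∀ {P R : Set} (p? : Dec P) (r? : Dec R) → P ⇔ R → 𝟙 p? ≡ 𝟙 r?
  𝟙-⇔ (yes _) (yes _) _   = refl
  𝟙-⇔ (no _)  (no _)  _   = refl
  𝟙-⇔ (yes p) (no ¬r) p⇔r = ⊥-elim (¬r (Equivalence.to p⇔r p))
  𝟙-⇔ (no ¬p) (yes r) p⇔r = ⊥-elim (¬p (Equivalence.from p⇔r r))

  ⌊⌋-true : ∀ {P : Set} (p? : Dec P) → ⌊ p? ⌋ ≡ true → P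
  ⌊⌋-true p? = toWitness ∘ Equivalence.from T-≡

  restrict : (A → Bool) → (A → ℕ) → A → ℕ
  restrict S g x = if S x then g x else 0

  restrict-≢0 : ∀ (S : A → Bool) (g : A → ℕ) x → restrict S g x ≢ 0 → S x ≡ true × g x ≢ 0
  restrict-≢0 S g x ≢0 with S x
  ... | true  = refl , ≢0
  ... | false = ⊥-elim (≢0 refl)

module IntegerParity where

  open import Data.Integer as ℤ using (ℤ; +_; -[1+_]; _⊖_; ∣_∣; _+_; _*_; _-_; -_)
  import Data.Integer.Properties as ℤ
  open import Algebra.Properties.AbelianGroup ℤ.+-0-abelianGroup using (∙-cancelʳ)
  open import Data.Integer.Tactic.RingSolver using (solve-∀)
  open import Data.Nat as ℕ using (zero; suc; _%_)
  import Data.Nat.Properties as ℕ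
  open import Data.Parity as ℙ using (Parity; 0ℙ; 1ℙ)
  import Data.Parity.Properties as ℙ
  open import Data.Product using (∃; _,_)
  open import Function using (_∘_)
  open import Relation.Binary.PropositionalEquality

  parity-cong-%2 : ∀ m n → m % 2 ≡ n % 2 → ℕ.parity m ≡ ℕ.parity n
  parity-cong-%2 m n eq = trans (sym (parity-%2 m)) (trans (cong ℕ.parity eq) (parity-%2 n))
    where parity-%2 : ∀ n → ℕ.parity (n % 2) ≡ ℕ.parity n
          parity-%2 0             = refl
          parity-%2 1             = refl
          parity-%2 (suc (suc n)) = parity-%2 n

  ℕ-even⇒n+n : ∀ n → ℕ.parity n ≡ 0ℙ → ∃ λ h → n ≡ h ℕ.+ h
  ℕ-even⇒n+n zero          _ = 0 , refl
  ℕ-even⇒n+n (suc (suc n)) p with ℕ-even⇒n+n n p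
  ... | h , refl = suc h , cong suc (sym (ℕ.+-suc h h))

  +≡0ℙ⇒≡ : ∀ {p q} → p ℙ.+ q ≡ 0ℙ → p ≡ q
  +≡0ℙ⇒≡ {0ℙ} {0ℙ} _ = refl
  +≡0ℙ⇒≡ {1ℙ} {1ℙ} _ = refl

  parity : ℤ → Parity
  parity i = ℕ.parity ∣ i ∣

  parity-neg : ∀ i → parity (- i) ≡ parity i
  parity-neg i = cong ℕ.parity (ℤ.∣-i∣≡∣i∣ i)

  parity-⊖ : ∀ m n → parity (m ⊖ n) ≡ ℕ.parity m ℙ.+ ℕ.parity n
  parity-⊖ m       zero    = sym (ℙ.+-identityʳ (ℕ.parity m))
  parity-⊖ zero    (suc n) = refl
  parity-⊖ (suc m) (suc n) = begin
    parity (suc m ⊖ suc n)                           ≡⟨ cong parity (ℤ.[1+m]⊖[1+n]≡m⊖n m n) ⟩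
    parity (m ⊖ n)                                   ≡⟨ parity-⊖ m n ⟩
    ℕ.parity m ℙ.+ ℕ.parity n                        ≡⟨ cong₂ ℙ._+_ (ℙ.suc-homo-⁻¹ m) (ℙ.suc-homo-⁻¹ n) ⟨
    ℕ.parity (suc m) ℙ.⁻¹ ℙ.+ ℕ.parity (suc n) ℙ.⁻¹  ≡⟨ ⁻¹+⁻¹ (ℕ.parity (suc m)) (ℕ.parity (suc n)) ⟩
    ℕ.parity (suc m) ℙ.+ ℕ.parity (suc n)            ∎
    where
    open ≡-Reasoning
    ⁻¹+⁻¹ : ∀ p q → p ℙ.⁻¹ ℙ.+ q ℙ.⁻¹ ≡ p ℙ.+ q
    ⁻¹+⁻¹ 0ℙ 0ℙ = refl
    ⁻¹+⁻¹ 0ℙ 1ℙ = refl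
    ⁻¹+⁻¹ 1ℙ 0ℙ = refl
    ⁻¹+⁻¹ 1ℙ 1ℙ = refl

  parity-+ : ∀ i j → parity (i + j) ≡ parity i ℙ.+ parity j
  parity-+ (+ m)    (+ n)    = ℙ.+-homo-+ m n
  parity-+ (+ m)    -[1+ n ] = parity-⊖ m (suc n)
  parity-+ -[1+ m ] (+ n)    = trans (parity-⊖ n (suc m)) (ℙ.+-comm (ℕ.parity n) _)
  parity-+ -[1+ m ] -[1+ n ] =
    trans (cong (ℕ.parity ∘ suc) (sym (ℕ.+-suc m n))) (ℙ.+-homo-+ (suc m) (suc n))

  parity-* : ∀ i j → parity (i * j) ≡ parity i ℙ.* parity j
  parity-* i j = trans (cong ℕ.parity (ℤ.abs-* i j)) (ℙ.*-homo-* ∣ i ∣ ∣ j ∣)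

  parity-sub : ∀ i j → parity (i - j) ≡ parity i ℙ.+ parity j
  parity-sub i j = trans (parity-+ i (- j)) (cong (parity i ℙ.+_) (parity-neg j))

  parity-square : ∀ i → parity (i * i) ≡ parity i
  parity-square i = trans (parity-* i i) (ℙ.*-idem (parity i))

  parity-double : ∀ i → parity (+ 2 * i) ≡ 0ℙ
  parity-double i = parity-* (+ 2) i

  parity-odd : ∀ i → parity (+ 2 * i - + 1) ≡ 1ℙ
  parity-odd i = trans (parity-sub (+ 2 * i) (+ 1)) (cong (ℙ._+ 1ℙ) (parity-double i))

  parity-odd-multiple : ∀ i j → parity ((+ 2 * i + + 1) * j) ≡ parity j
  parity-odd-multiple i j =
    trans (parity-* (+ 2 * i + + 1) j) (cong (ℙ._* parity j) (trans (parity-+ (+ 2 * i) (+ 1)) (cong (ℙ._+ 1ℙ) (parity-double i))))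

  even⇒double : ∀ i → parity i ≡ 0ℙ → ∃ λ h → i ≡ + 2 * h
  even⇒double (+ n) p with ℕ-even⇒n+n n p
  ... | h , refl = + h , trans (ℤ.pos-+ h h) (twice (+ h))
    where twice : ∀ i → i + i ≡ + 2 * i
          twice = solve-∀
  even⇒double -[1+ n ] p with ℕ-even⇒n+n (suc n) p
  ... | h , 1+n≡h+h = - + h , trans (cong (λ m → - + m) 1+n≡h+h) (trans (cong -_ (ℤ.pos-+ h h)) (negated-twice (+ h)))
    where negated-twice : ∀ i → - (i + i) ≡ + 2 * - i
          negated-twice = solve-∀

  odd⇒double-1 : ∀ i → parity i ≡ 1ℙ → ∃ λ h → i ≡ + 2 * h - + 1
  odd⇒double-1 i p with even⇒double (i + + 1) (trans (parity-+ i (+ 1)) (cong (ℙ._+ 1ℙ) p))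
  ... | h , i+1≡2h = h , trans (shift i) (cong (_- + 1) i+1≡2h)
    where shift : ∀ i → i ≡ (i + + 1) - + 1
          shift = solve-∀

  same-parity⇒double : ∀ {i j} → parity i ≡ parity j → ∃ λ h → i ≡ j + + 2 * h
  same-parity⇒double {i} {j} i≈j
    with even⇒double (i - j) (trans (parity-sub i j) (trans (cong (ℙ._+ parity j) i≈j) (ℙ.p+p≡0ℙ (parity j))))
  ... | h , i-j≡2h = h , trans (split i j) (cong (λ k → j + k) i-j≡2h)
    where split : ∀ i j → i ≡ j + (i - j)
          split = solve-∀

  2*-injective : ∀ {i j} → + 2 * i ≡ + 2 * j → i ≡ j
  2*-injective {i} {j} = ℤ.*-cancelˡ-≡ (+ 2) i j

  2*-1-injective : ∀ {i j} → + 2 * i - + 1 ≡ + 2 * j - + 1 → i ≡ j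
  2*-1-injective eq = 2*-injective (∙-cancelʳ (- + 1) _ _ eq)

module TriangularNumbers where

  open import Data.Empty using (⊥-elim)
  open import Data.Integer as ℤ using (ℤ; +_; -[1+_]; ∣_∣; _+_; _*_; _-_)
  open import Data.Integer.DivMod using (_/ℕ_; _%ℕ_; n%ℕd<d; a≡a%ℕn+[a/ℕn]*n)
  import Data.Integer.Properties as ℤ
  open import Data.Integer.Tactic.RingSolver using (solve-∀)
  open import Data.Nat as ℕ using (zero; suc; z≤n; s≤s)
  import Data.Nat.Properties as ℕ
  open import Data.Parity as ℙ using (0ℙ; 1ℙ)
  open import Data.Product using (∃; _×_; _,_)
  open import Relation.Binary.PropositionalEquality
  open import Defs using (tri)
  open IntegerParity

  half-double : ∀ h → (+ 2 * h) /ℕ 2 ≡ h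
  half-double h = quotient (+ 2 * h %ℕ 2) (n%ℕd<d (+ 2 * h) 2) (a≡a%ℕn+[a/ℕn]*n (+ 2 * h) 2)
    where
    quotient : ∀ r {q} → r ℕ.< 2 → + 2 * h ≡ + r + q * + 2 → q ≡ h
    quotient 0 {q} _ eq = 2*-injective (trans (ℤ.*-comm (+ 2) q) (trans (sym (ℤ.+-identityˡ _)) (sym eq)))
    quotient 1 {q} _ eq = ⊥-elim (0ℙ≢1ℙ (begin
      0ℙ                       ≡⟨ parity-double h ⟨
      parity (+ 2 * h)         ≡⟨ cong parity eq ⟩
      parity (+ 1 + q * + 2)   ≡⟨ parity-+ (+ 1) (q * + 2) ⟩
      1ℙ ℙ.+ parity (q * + 2)  ≡⟨ cong (λ i → 1ℙ ℙ.+ parity i) (ℤ.*-comm q (+ 2)) ⟩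
      1ℙ ℙ.+ parity (+ 2 * q)  ≡⟨ cong (1ℙ ℙ.+_) (parity-double q) ⟩
      1ℙ                       ∎))
      where open ≡-Reasoning
            0ℙ≢1ℙ : 0ℙ ≢ 1ℙ
            0ℙ≢1ℙ ()
    quotient (suc (suc _)) (s≤s (s≤s ())) _

  parity-consecutive : ∀ i → parity (i * (i - + 1)) ≡ 0ℙ
  parity-consecutive i =
    trans (parity-* i (i - + 1)) (trans (cong (parity i ℙ.*_) (parity-sub i (+ 1))) (p[p+1]≡0 (parity i)))
    where p[p+1]≡0 : ∀ p → p ℙ.* (p ℙ.+ 1ℙ) ≡ 0ℙ
          p[p+1]≡0 0ℙ = refl
          p[p+1]≡0 1ℙ = refl

  tri-double : ∀ x → x * (x - + 1) ≡ + 2 * tri x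
  tri-double x with even⇒double (x * (x - + 1)) (parity-consecutive x)
  ... | h , eq = trans eq (cong (+ 2 *_) (sym (trans (cong (_/ℕ 2) eq) (half-double h))))

  odd-square : ∀ h → (+ 2 * h - + 1) * (+ 2 * h - + 1) ≡ + 8 * tri h + + 1
  odd-square h = trans (expand h) (trans (cong (λ i → + 4 * i + + 1) (tri-double h)) (regroup (tri h)))
    where expand : ∀ h → (+ 2 * h - + 1) * (+ 2 * h - + 1) ≡ + 4 * (h * (h - + 1)) + + 1
          expand = solve-∀
          regroup : ∀ t → + 4 * (+ 2 * t) + + 1 ≡ + 8 * t + + 1
          regroup = solve-∀

  half-of-natural : ∀ {i n} → + 2 * i ≡ + n → ∃ λ h → i ≡ + h × 2 ℕ.* h ≡ n
  half-of-natural {+ h} eq = h , refl , ℤ.+-injective (trans (ℤ.pos-* 2 h) eq)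

  tri-bound : ∀ x → ∃ λ t → tri x ≡ + t × ∣ x ∣ ℕ.≤ 1 ℕ.+ t
  tri-bound (+ zero) = 0 , refl , z≤n
  tri-bound (+ suc j) with half-of-natural (trans (sym (tri-double (+ suc j))) (sym (ℤ.pos-* (suc j) j)))
  ... | t , tri≡t , 2t≡[1+j]j = t , tri≡t , s≤s (ℕ.*-cancelˡ-≤ 2 (subst (2 ℕ.* j ℕ.≤_) (sym 2t≡[1+j]j) (2j≤[1+j]j j)))
    where 2j≤[1+j]j : ∀ j → 2 ℕ.* j ℕ.≤ suc j ℕ.* j
          2j≤[1+j]j zero    = z≤n
          2j≤[1+j]j (suc i) = ℕ.*-monoˡ-≤ (suc i) {2} {suc (suc i)} (s≤s (s≤s z≤n))
  tri-bound -[1+ j ] with half-of-natural (sym (tri-double -[1+ j ]))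
  ... | t , tri≡t , 2t≡[1+j][2+k] =
    t , tri≡t , ℕ.m≤n⇒m≤1+n (ℕ.*-cancelˡ-≤ 2 (subst (2 ℕ.* suc j ℕ.≤_) (sym 2t≡[1+j][2+k]) (2[1+j]≤[1+j][2+k] _)))
    where 2[1+j]≤[1+j][2+k] : ∀ k → 2 ℕ.* suc j ℕ.≤ suc j ℕ.* suc (suc k)
          2[1+j]≤[1+j][2+k] k =
            ℕ.≤-trans (ℕ.≤-reflexive (ℕ.*-comm 2 (suc j))) (ℕ.*-monoʳ-≤ (suc j) {2} {suc (suc k)} (s≤s (s≤s z≤n)))

module DiagonalForms where

  open import Data.Empty using (⊥)
  open import Data.Integer as ℤ using (ℤ; +_; -[1+_]; ∣_∣; _+_; _*_; _-_)
  import Data.Integer.Properties as ℤ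
  open import Data.Integer.Tactic.RingSolver using (solve-∀)
  open import Data.List using (List; _∷_; []; map; concatMap; upTo; _++_; cartesianProduct)
  open import Data.List.Properties using (map-++; map-∘; concatMap-cong)
  open import Data.List.Membership.Propositional using (_∈_)
  open import Data.List.Membership.Propositional.Properties
    using (∈-map⁺; ∈-map⁻; ∈-++⁺ˡ; ∈-++⁺ʳ; ∈-upTo⁺; ∈-cartesianProduct⁺)
  open import Data.List.Relation.Unary.Unique.Propositional using (Unique)
  import Data.List.Relation.Unary.Unique.Propositional.Properties as Unique
  open import Data.Nat as ℕ using (ℕ; zero; suc; z≤n; s≤s; _≤_)
  open import Data.Nat.ListAction using (sum)
  import Data.Nat.Properties as ℕ
  open import Data.Parity as ℙ using (0ℙ)
  open import Data.Product using (∃; _×_; _,_; proj₁; proj₂)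
  open import Function using (_∘_)
  open import Relation.Binary.PropositionalEquality
  open import Defs using (range; count4; tri)
  open Sums using (sumOver; 𝟙)
  open IntegerParity
  open TriangularNumbers

  private variable
    A B C : Set

  P4 : Set
  P4 = ℤ × ℤ × ℤ × ℤ

  box : ℕ → List P4
  box n = cartesianProduct (range n) (cartesianProduct (range n) (cartesianProduct (range n) (range n)))

  map-cartesianProduct : ∀ (g : A × B → C) xs ys →
                         map g (cartesianProduct xs ys) ≡ concatMap (λ x → map (λ y → g (x , y)) ys) xs
  map-cartesianProduct g []       ys = refl
  map-cartesianProduct g (x ∷ xs) ys = begin
    map g (map (x ,_) ys ++ cartesianProduct xs ys)          ≡⟨ map-++ g (map (x ,_) ys) _ ⟩
    map g (map (x ,_) ys) ++ map g (cartesianProduct xs ys)  ≡⟨ cong₂ _++_ (sym (map-∘ ys)) (map-cartesianProduct g xs ys) ⟩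
    map (λ y → g (x , y)) ys ++ concatMap (λ x → map (λ y → g (x , y)) ys) xs ∎
    where open ≡-Reasoning

  count4≡sumOver-box : ∀ n F v → count4 n F v ≡ sumOver (box n) (λ (x , y , z , w) → 𝟙 (F x y z w ℤ.≟ v))
  count4≡sumOver-box n F v = sym (cong sum
    (trans (map-cartesianProduct _ R _) (concatMap-cong (λ x →
      trans (map-cartesianProduct _ R _) (concatMap-cong (λ y →
        map-cartesianProduct _ R R) R)) R)))
    where R = range n

  range-unique : ∀ n → Unique (range n)
  range-unique n = Unique.++⁺ (Unique.map⁺ +-injective (Unique.upTo⁺ (suc n))) (Unique.map⁺ -[1+-injective (Unique.upTo⁺ n)) disjoint
    where
    +-injective : ∀ {i j} → + i ≡ + j → i ≡ j
    +-injective refl = refl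
    -[1+-injective : ∀ {i j} → -[1+ i ] ≡ -[1+ j ] → i ≡ j
    -[1+-injective refl = refl
    disjoint : ∀ {x} → x ∈ map +_ (upTo (suc n)) × x ∈ map -[1+_] (upTo n) → ⊥
    disjoint (x∈⁺ , x∈⁻) with ∈-map⁻ +_ x∈⁺ | ∈-map⁻ -[1+_] x∈⁻
    ... | _ , _ , refl | _ , _ , ()

  box-unique : ∀ n → Unique (box n)
  box-unique n = Unique.cartesianProduct⁺ R (Unique.cartesianProduct⁺ R (Unique.cartesianProduct⁺ R R))
    where R = range-unique n

  InBox : ℕ → P4 → Set
  InBox n (x , y , z , w) = ∣ x ∣ ≤ n × ∣ y ∣ ≤ n × ∣ z ∣ ≤ n × ∣ w ∣ ≤ n

  ∈-range : ∀ {n} x → ∣ x ∣ ≤ n → x ∈ range n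
  ∈-range {n} (+ i)    i≤n = ∈-++⁺ˡ (∈-map⁺ +_ (∈-upTo⁺ (s≤s i≤n)))
  ∈-range {n} -[1+ i ] i<n = ∈-++⁺ʳ (map +_ (upTo (suc n))) (∈-map⁺ -[1+_] (∈-upTo⁺ i<n))

  InBox⇒∈box : ∀ {n} p → InBox n p → p ∈ box n
  InBox⇒∈box (x , y , z , w) (x≤ , y≤ , z≤ , w≤) =
    ∈-cartesianProduct⁺ (∈-range x x≤)
      (∈-cartesianProduct⁺ (∈-range y y≤) (∈-cartesianProduct⁺ (∈-range z z≤) (∈-range w w≤)))

  diagonal : (ℤ → ℤ) → ℕ → ℕ → ℕ → ℕ → P4 → ℤ
  diagonal f a b c d (x , y , z , w) = + a * f x + + b * f y + + c * f z + + d * f w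

  square : ℤ → ℤ
  square x = x * x

  summands≤sum : ∀ {a b c d u₁ u₂ u₃ u₄} → 1 ≤ a → 1 ≤ b → 1 ≤ c → 1 ≤ d →
    let s = a ℕ.* u₁ ℕ.+ b ℕ.* u₂ ℕ.+ c ℕ.* u₃ ℕ.+ d ℕ.* u₄ in
    u₁ ≤ s × u₂ ≤ s × u₃ ≤ s × u₄ ≤ s
  summands≤sum {a} {b} {c} {d} {u₁} {u₂} {u₃} {u₄} 1≤a 1≤b 1≤c 1≤d =
    ℕ.≤-trans (scaled 1≤a) (ℕ.≤-trans (ℕ.m≤m+n au bu) (ℕ.≤-trans (ℕ.m≤m+n (au ℕ.+ bu) cu) (ℕ.m≤m+n _ du))) ,
    ℕ.≤-trans (scaled 1≤b) (ℕ.≤-trans (ℕ.m≤n+m bu au) (ℕ.≤-trans (ℕ.m≤m+n (au ℕ.+ bu) cu) (ℕ.m≤m+n _ du))) ,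
    ℕ.≤-trans (scaled 1≤c) (ℕ.≤-trans (ℕ.m≤n+m cu (au ℕ.+ bu)) (ℕ.m≤m+n _ du)) ,
    ℕ.≤-trans (scaled 1≤d) (ℕ.m≤n+m du _)
    where
    au = a ℕ.* u₁
    bu = b ℕ.* u₂
    cu = c ℕ.* u₃
    du = d ℕ.* u₄
    scaled : ∀ {k u} → 1 ≤ k → u ≤ k ℕ.* u
    scaled {k} {u} 1≤k = ℕ.m≤n*m u k {{ℕ.>-nonZero 1≤k}}

  diagonal-InBox : ∀ {f e a b c d v} → (∀ x → ∃ λ u → f x ≡ + u × ∣ x ∣ ≤ e ℕ.+ u) →
                   1 ≤ a → 1 ≤ b → 1 ≤ c → 1 ≤ d →
                   ∀ p → diagonal f a b c d p ≡ + v → InBox (e ℕ.+ v) p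
  diagonal-InBox {f} {e} {a} {b} {c} {d} {v} f-bound 1≤a 1≤b 1≤c 1≤d (x , y , z , w) eq
    with f-bound x | f-bound y | f-bound z | f-bound w
  ... | u₁ , fx , x≤ | u₂ , fy , y≤ | u₃ , fz , z≤ | u₄ , fw , w≤
    with summands≤sum {u₁ = u₁} {u₂} {u₃} {u₄} 1≤a 1≤b 1≤c 1≤d
  ... | u₁≤ , u₂≤ , u₃≤ , u₄≤ = widen x≤ u₁≤ , widen y≤ u₂≤ , widen z≤ u₃≤ , widen w≤ u₄≤
    where
    s = a ℕ.* u₁ ℕ.+ b ℕ.* u₂ ℕ.+ c ℕ.* u₃ ℕ.+ d ℕ.* u₄
    term : ∀ k {i u} → i ≡ + u → + k * i ≡ + (k ℕ.* u)
    term k {u = u} i≡u = trans (cong (+ k *_) i≡u) (sym (ℤ.pos-* k u))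
    s≡v : s ≡ v
    s≡v = ℤ.+-injective (begin
      + s
        ≡⟨ trans (ℤ.pos-+ _ (d ℕ.* u₄)) (cong (_+ + (d ℕ.* u₄))
             (trans (ℤ.pos-+ _ (c ℕ.* u₃)) (cong (_+ + (c ℕ.* u₃)) (ℤ.pos-+ (a ℕ.* u₁) (b ℕ.* u₂))))) ⟩
      + (a ℕ.* u₁) + + (b ℕ.* u₂) + + (c ℕ.* u₃) + + (d ℕ.* u₄)
        ≡⟨ cong₂ _+_ (cong₂ _+_ (cong₂ _+_ (term a fx) (term b fy)) (term c fz)) (term d fw) ⟨
      diagonal f a b c d (x , y , z , w)
        ≡⟨ eq ⟩
      + v ∎)
      where open ≡-Reasoning
    widen : ∀ {k u} → k ≤ e ℕ.+ u → u ≤ s → k ≤ e ℕ.+ v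
    widen k≤ u≤ = ℕ.≤-trans k≤ (ℕ.+-monoʳ-≤ e (subst (_ ≤_) s≡v u≤))

  square-bound : ∀ x → ∃ λ u → square x ≡ + u × ∣ x ∣ ≤ 0 ℕ.+ u
  square-bound x = ∣ x ∣ ℕ.* ∣ x ∣ , square≡ x , ≤square ∣ x ∣
    where
    square≡ : ∀ x → x * x ≡ + (∣ x ∣ ℕ.* ∣ x ∣)
    square≡ (+ i)    = sym (ℤ.pos-* i i)
    square≡ -[1+ i ] = refl
    ≤square : ∀ n → n ≤ n ℕ.* n
    ≤square zero    = z≤n
    ≤square (suc n) = ℕ.m≤m*n (suc n) (suc n)

  parity-diagonal-square : ∀ a b c d x y z w →
    parity (diagonal square a b c d (x , y , z , w))
    ≡ (ℕ.parity a ℙ.* parity x) ℙ.+ (ℕ.parity b ℙ.* parity y) ℙ.+ (ℕ.parity c ℙ.* parity z) ℙ.+ (ℕ.parity d ℙ.* parity w)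
  parity-diagonal-square a b c d x y z w =
    trans (parity-+ (+ a * square x + + b * square y + + c * square z) (+ d * square w)) (cong₂ ℙ._+_
      (trans (parity-+ (+ a * square x + + b * square y) (+ c * square z)) (cong₂ ℙ._+_
        (trans (parity-+ (+ a * square x) (+ b * square y)) (cong₂ ℙ._+_ (term a x) (term b y)))
        (term c z)))
      (term d w))
    where term : ∀ k i → parity (+ k * square i) ≡ ℕ.parity k ℙ.* parity i
          term k i = trans (parity-* (+ k) (i * i)) (cong (ℕ.parity k ℙ.*_) (parity-square i))

  double : P4 → P4
  double (x , y , z , w) = (+ 2 * x , + 2 * y , + 2 * z , + 2 * w)

  double-injective : ∀ {p q} → double p ≡ double q → p ≡ q
  double-injective eq =
    cong₂ _,_ (2*-injective (cong proj₁ eq)) (cong₂ _,_ (2*-injective (cong (proj₁ ∘ proj₂) eq))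
      (cong₂ _,_ (2*-injective (cong (proj₁ ∘ proj₂ ∘ proj₂) eq)) (2*-injective (cong (proj₂ ∘ proj₂ ∘ proj₂) eq))))

  diagonal-double : ∀ a b c d p → diagonal square a b c d (double p) ≡ + 4 * diagonal square a b c d p
  diagonal-double a b c d (x , y , z , w) = scale (+ a) (+ b) (+ c) (+ d) x y z w
    where scale : ∀ A B C D x y z w →
            A * ((+ 2 * x) * (+ 2 * x)) + B * ((+ 2 * y) * (+ 2 * y)) + C * ((+ 2 * z) * (+ 2 * z)) + D * ((+ 2 * w) * (+ 2 * w))
            ≡ + 4 * (A * (x * x) + B * (y * y) + C * (z * z) + D * (w * w))
          scale = solve-∀

  even⇒doubled : ∀ x y z w → parity x ≡ 0ℙ → parity y ≡ 0ℙ → parity z ≡ 0ℙ → parity w ≡ 0ℙ →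
                 ∃ λ p → double p ≡ (x , y , z , w)
  even⇒doubled x y z w x-even y-even z-even w-even =
    let x′ , x≡ = even⇒double x x-even
        y′ , y≡ = even⇒double y y-even
        z′ , z≡ = even⇒double z z-even
        w′ , w≡ = even⇒double w w-even
    in  (x′ , y′ , z′ , w′) , sym (cong₂ _,_ x≡ (cong₂ _,_ y≡ (cong₂ _,_ z≡ w≡)))

  oddLift : P4 → P4
  oddLift (x , y , z , w) = (+ 2 * x - + 1 , + 2 * y - + 1 , + 2 * z - + 1 , + 2 * w - + 1)

  oddLift-injective : ∀ {p q} → oddLift p ≡ oddLift q → p ≡ q
  oddLift-injective eq =
    cong₂ _,_ (2*-1-injective (cong proj₁ eq)) (cong₂ _,_ (2*-1-injective (cong (proj₁ ∘ proj₂) eq))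
      (cong₂ _,_ (2*-1-injective (cong (proj₁ ∘ proj₂ ∘ proj₂) eq)) (2*-1-injective (cong (proj₂ ∘ proj₂ ∘ proj₂) eq))))

  diagonal-oddLift : ∀ a b c d p →
    diagonal square a b c d (oddLift p) ≡ + 8 * diagonal tri a b c d p + + (a ℕ.+ b ℕ.+ c ℕ.+ d)
  diagonal-oddLift a b c d (x , y , z , w) = begin
    diagonal square a b c d (oddLift (x , y , z , w))
      ≡⟨ cong₂ _+_ (cong₂ _+_ (cong₂ _+_ (cong (+ a *_) (odd-square x)) (cong (+ b *_) (odd-square y)))
                              (cong (+ c *_) (odd-square z))) (cong (+ d *_) (odd-square w)) ⟩
    + a * (+ 8 * tri x + + 1) + + b * (+ 8 * tri y + + 1) + + c * (+ 8 * tri z + + 1) + + d * (+ 8 * tri w + + 1)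
      ≡⟨ collect (+ a) (+ b) (+ c) (+ d) (tri x) (tri y) (tri z) (tri w) ⟩
    + 8 * diagonal tri a b c d (x , y , z , w) + (+ a + + b + + c + + d)
      ≡⟨ cong₂ _+_ (refl {x = + 8 * diagonal tri a b c d (x , y , z , w)}) (sym (pos-+₄ a b c d)) ⟩
    + 8 * diagonal tri a b c d (x , y , z , w) + + (a ℕ.+ b ℕ.+ c ℕ.+ d) ∎
    where
    open ≡-Reasoning
    collect : ∀ A B C D s t u v →
      A * (+ 8 * s + + 1) + B * (+ 8 * t + + 1) + C * (+ 8 * u + + 1) + D * (+ 8 * v + + 1)
      ≡ + 8 * (A * s + B * t + C * u + D * v) + (A + B + C + D)
    collect = solve-∀
    pos-+₄ : ∀ a b c d → + (a ℕ.+ b ℕ.+ c ℕ.+ d) ≡ + a + + b + + c + + d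
    pos-+₄ a b c d = trans (ℤ.pos-+ (a ℕ.+ b ℕ.+ c) d) (cong (_+ + d) (trans (ℤ.pos-+ (a ℕ.+ b) c) (cong (_+ + c) (ℤ.pos-+ a b))))

module EisensteinCoordinates where

  open import Data.Integer as ℤ using (ℤ; +_; ∣_∣; _+_; _*_; _-_; -_)
  import Data.Integer.Properties as ℤ
  open import Algebra.Properties.AbelianGroup ℤ.+-0-abelianGroup using (∙-cancelˡ)
  open import Data.Integer.Tactic.RingSolver using (solve-∀)
  open import Data.Nat as ℕ using (_≤_)
  import Data.Nat.Properties as ℕ
  open import Data.Parity as ℙ using (1ℙ)
  open import Data.Product using (∃; _,_; proj₁; proj₂)
  open import Function using (_∘_)
  open import Relation.Binary.PropositionalEquality
  open IntegerParity
  open DiagonalForms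

  shear : P4 → P4
  shear (j , y , z , w) = (y + + 2 * j , y , z , w)

  rotate : P4 → P4
  rotate (j , y , z , w) = (y , - (j + y) , z , w)

  eisenstein : ℤ → ℤ → ℤ
  eisenstein j y = j * j + j * y + y * y

  shear-injective : ∀ {p q} → shear p ≡ shear q → p ≡ q
  shear-injective {j , y , z , w} {j′ , y′ , z′ , w′} eq with cong (proj₁ ∘ proj₂) eq | cong (proj₂ ∘ proj₂) eq
  ... | refl | refl = cong (_, y , z , w) (2*-injective (∙-cancelˡ y _ _ (cong proj₁ eq)))

  InBox-shear : ∀ {v} q → InBox v (shear q) → InBox v q
  InBox-shear {v} (j , y , z , w) (x≤ , y≤ , z≤ , w≤) = ℕ.*-cancelˡ-≤ 2 2∣j∣≤2v , y≤ , z≤ , w≤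
    where
    2∣j∣≤2v : 2 ℕ.* ∣ j ∣ ≤ 2 ℕ.* v
    2∣j∣≤2v = begin
      2 ℕ.* ∣ j ∣                ≡⟨ ℤ.abs-* (+ 2) j ⟨
      ∣ + 2 * j ∣                ≡⟨ cong ∣_∣ (difference y j) ⟩
      ∣ (y + + 2 * j) - y ∣      ≤⟨ ℤ.∣i-j∣≤∣i∣+∣j∣ (y + + 2 * j) y ⟩
      ∣ y + + 2 * j ∣ ℕ.+ ∣ y ∣  ≤⟨ ℕ.+-mono-≤ x≤ y≤ ⟩
      v ℕ.+ v                    ≡⟨ cong (v ℕ.+_) (ℕ.+-identityʳ v) ⟨
      2 ℕ.* v                    ∎
      where open ℕ.≤-Reasoning
            difference : ∀ y j → + 2 * j ≡ (y + + 2 * j) - y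
            difference = solve-∀

  rotate³ : ∀ q → rotate (rotate (rotate q)) ≡ q
  rotate³ (j , y , z , w) = cong₂ _,_ (first j y) (cong (_, z , w) (second j y))
    where first : ∀ j y → - (y + - (j + y)) ≡ j
          first = solve-∀
          second : ∀ j y → - (- (j + y) + - (y + - (j + y))) ≡ y
          second = solve-∀

  rotate-injective : ∀ {p q} → rotate p ≡ rotate q → p ≡ q
  rotate-injective {p} {q} eq = trans (sym (rotate³ p)) (trans (cong (rotate ∘ rotate) eq) (rotate³ q))

  eisenstein-rotate : ∀ j y → eisenstein y (- (j + y)) ≡ eisenstein j y
  eisenstein-rotate = identity
    where identity : ∀ j y → y * y + y * - (j + y) + - (j + y) * - (j + y) ≡ j * j + j * y + y * y
          identity = solve-∀

  diagonal-shear : ∀ a c d j y z w →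
    diagonal square a (3 ℕ.* a) c d (shear (j , y , z , w)) ≡ + 4 * (+ a * eisenstein j y) + + c * square z + + d * square w
  diagonal-shear a c d j y z w =
    trans (cong (λ b → + a * square (y + + 2 * j) + b * square y + + c * square z + + d * square w) (ℤ.pos-* 3 a))
          (expand (+ a) (+ c) (+ d) j y z w)
    where expand : ∀ A C D j y z w →
            A * ((y + + 2 * j) * (y + + 2 * j)) + + 3 * A * (y * y) + C * (z * z) + D * (w * w)
            ≡ + 4 * (A * (j * j + j * y + y * y)) + C * (z * z) + D * (w * w)
          expand = solve-∀

  diagonal-shear-rotate : ∀ a c d q →
    diagonal square a (3 ℕ.* a) c d (shear (rotate q)) ≡ diagonal square a (3 ℕ.* a) c d (shear q)
  diagonal-shear-rotate a c d (j , y , z , w) = begin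
    diagonal square a (3 ℕ.* a) c d (shear (rotate (j , y , z , w)))
      ≡⟨ diagonal-shear a c d y (- (j + y)) z w ⟩
    + 4 * (+ a * eisenstein y (- (j + y))) + + c * square z + + d * square w
      ≡⟨ cong (λ e → + 4 * (+ a * e) + + c * square z + + d * square w) (eisenstein-rotate j y) ⟩
    + 4 * (+ a * eisenstein j y) + + c * square z + + d * square w
      ≡⟨ diagonal-shear a c d j y z w ⟨
    diagonal square a (3 ℕ.* a) c d (shear (j , y , z , w)) ∎
    where open ≡-Reasoning

  parity-eisenstein : ∀ j y →
    parity (eisenstein j y) ≡ (parity j ℙ.* parity j) ℙ.+ (parity j ℙ.* parity y) ℙ.+ (parity y ℙ.* parity y)
  parity-eisenstein j y = trans (parity-+ (j * j + j * y) (y * y))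
    (cong₂ ℙ._+_ (trans (parity-+ (j * j) (j * y)) (cong₂ ℙ._+_ (parity-* j j) (parity-* j y))) (parity-* y y))

  shear-double : ∀ q → shear (double q) ≡ double (shear q)
  shear-double (j , y , z , w) = cong (_, + 2 * y , + 2 * z , + 2 * w) (distrib y j)
    where distrib : ∀ y j → + 2 * y + + 2 * (+ 2 * j) ≡ + 2 * (y + + 2 * j)
          distrib = solve-∀

  shearedOddLift : P4 → P4
  shearedOddLift (x , y , z , w) = (x - y , + 2 * y - + 1 , + 2 * z - + 1 , + 2 * w - + 1)

  shear-shearedOddLift : ∀ p → shear (shearedOddLift p) ≡ oddLift p
  shear-shearedOddLift (x , y , z , w) = cong (_, + 2 * y - + 1 , + 2 * z - + 1 , + 2 * w - + 1) (telescope x y)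
    where telescope : ∀ x y → + 2 * y - + 1 + + 2 * (x - y) ≡ + 2 * x - + 1
          telescope = solve-∀

  shearedOddLift-injective : ∀ {p q} → shearedOddLift p ≡ shearedOddLift q → p ≡ q
  shearedOddLift-injective {p} {q} eq =
    oddLift-injective (trans (sym (shear-shearedOddLift p)) (trans (cong shear eq) (shear-shearedOddLift q)))

  odd⇒shearedOddLift : ∀ j y z w → parity y ≡ 1ℙ → parity z ≡ 1ℙ → parity w ≡ 1ℙ →
                       ∃ λ p → shearedOddLift p ≡ (j , y , z , w)
  odd⇒shearedOddLift j y z w y-odd z-odd w-odd =
    let y′ , y≡ = odd⇒double-1 y y-odd
        z′ , z≡ = odd⇒double-1 z z-odd
        w′ , w≡ = odd⇒double-1 w w-odd
    in  (j + y′ , y′ , z′ , w′) , sym (cong₂ _,_ (cancel j y′) (cong₂ _,_ y≡ (cong₂ _,_ z≡ w≡)))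
    where cancel : ∀ j y → j ≡ j + y - y
          cancel = solve-∀

module Counting (a k m n : ℕ) (a-odd : ℕ.parity a ≡ 1ℙ) (k≈m : ℕ.parity k ≡ ℕ.parity m) where

  open import Data.Bool using (Bool; true; if_then_else_)
  open import Data.Integer as ℤ using (ℤ; +_; _+_; _*_; _-_)
  import Data.Integer.Properties as ℤ
  open import Algebra.Properties.AbelianGroup ℤ.+-0-abelianGroup using (∙-cancelʳ)
  open import Data.Integer.Tactic.RingSolver using (solve-∀)
  open import Data.List.Membership.Propositional using (_∈_)
  open import Data.Nat.Tactic.RingSolver as ℕ-Solver using ()
  open import Data.Parity as ℙ using (Parity; 0ℙ; 1ℙ)
  import Data.Parity.Properties as ℙ
  open import Data.Product using (∃; _×_; _,_; proj₁; proj₂)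
  open import Data.Product.Properties using (≡-dec)
  open import Function using (_∘_; mk⇔)
  open import Relation.Nullary.Decidable using (⌊_⌋)
  open import Relation.Binary.PropositionalEquality
  import Data.Nat.Properties as ℕP
  open import Defs using (N; t; tri)
  open Sums
  open IntegerParity
  open TriangularNumbers
  open DiagonalForms
  open EisensteinCoordinates

  c d : ℕ
  c = 4 ℕ.* k ℕ.+ 2
  d = 4 ℕ.* m ℕ.+ 2

  K M : ℤ
  K = + k
  M = + m

  Q : P4 → ℤ
  Q = diagonal square a (3 ℕ.* a) c d

  target quarter : ℕ
  target  = 8 ℕ.* n ℕ.+ 4 ℕ.* m ℕ.+ 4 ℕ.* k ℕ.+ 4 ℕ.* a ℕ.+ 4
  quarter = 2 ℕ.* n ℕ.+ m ℕ.+ k ℕ.+ a ℕ.+ 1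

  target≡4*quarter : target ≡ 4 ℕ.* quarter
  target≡4*quarter = identity n m k a
    where identity : ∀ n m k a → 8 ℕ.* n ℕ.+ 4 ℕ.* m ℕ.+ 4 ℕ.* k ℕ.+ 4 ℕ.* a ℕ.+ 4
                               ≡ 4 ℕ.* (2 ℕ.* n ℕ.+ m ℕ.+ k ℕ.+ a ℕ.+ 1)
          identity = ℕ-Solver.solve-∀

  +target≡4*quarter : + target ≡ + 4 * + quarter
  +target≡4*quarter = trans (cong +_ target≡4*quarter) (ℤ.pos-* 4 quarter)

  parity-quarter : ℕ.parity quarter ≡ 0ℙ
  parity-quarter = begin
    ℕ.parity quarter
      ≡⟨ trans (ℙ.+-homo-+ (2 ℕ.* n ℕ.+ m ℕ.+ k ℕ.+ a) 1) (cong (ℙ._+ 1ℙ)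
           (trans (ℙ.+-homo-+ (2 ℕ.* n ℕ.+ m ℕ.+ k) a) (cong₂ ℙ._+_
             (trans (ℙ.+-homo-+ (2 ℕ.* n ℕ.+ m) k) (cong (ℙ._+ ℕ.parity k) (ℙ.+-homo-+ (2 ℕ.* n) m))) a-odd))) ⟩
    ℕ.parity (2 ℕ.* n) ℙ.+ ℕ.parity m ℙ.+ ℕ.parity k ℙ.+ 1ℙ ℙ.+ 1ℙ
      ≡⟨ cong (λ p → p ℙ.+ ℕ.parity m ℙ.+ ℕ.parity k ℙ.+ 1ℙ ℙ.+ 1ℙ) (ℙ.*-homo-* 2 n) ⟩
    ℕ.parity m ℙ.+ ℕ.parity k ℙ.+ 1ℙ ℙ.+ 1ℙ
      ≡⟨ cong (λ p → ℕ.parity m ℙ.+ p ℙ.+ 1ℙ ℙ.+ 1ℙ) k≈m ⟩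
    ℕ.parity m ℙ.+ ℕ.parity m ℙ.+ 1ℙ ℙ.+ 1ℙ
      ≡⟨ vanish (ℕ.parity m) ⟩
    0ℙ ∎
    where open ≡-Reasoning
          vanish : ∀ p → p ℙ.+ p ℙ.+ 1ℙ ℙ.+ 1ℙ ≡ 0ℙ
          vanish 0ℙ = refl
          vanish 1ℙ = refl

  parity-target : ℕ.parity target ≡ 0ℙ
  parity-target = trans (cong ℕ.parity target≡4*quarter) (ℙ.*-homo-* 4 quarter)

  1≤a : 1 ℕ.≤ a
  1≤a = odd⇒positive a a-odd
    where odd⇒positive : ∀ i → ℕ.parity i ≡ 1ℙ → 1 ℕ.≤ i
          odd⇒positive (ℕ.suc i) _ = ℕ.s≤s ℕ.z≤n

  1≤4i+2 : ∀ i → 1 ℕ.≤ 4 ℕ.* i ℕ.+ 2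
  1≤4i+2 i = ℕP.≤-trans (ℕ.s≤s ℕ.z≤n) (ℕP.m≤n+m 2 (4 ℕ.* i))

  1≤3a : 1 ℕ.≤ 3 ℕ.* a
  1≤3a = ℕP.≤-trans 1≤a (ℕP.m≤m+n a _)

  solution-InBox : ∀ {v} p → Q p ≡ + v → InBox v p
  solution-InBox = diagonal-InBox square-bound 1≤a 1≤3a (1≤4i+2 k) (1≤4i+2 m)

  parity-4i+2 : ∀ i → ℕ.parity (4 ℕ.* i ℕ.+ 2) ≡ 0ℙ
  parity-4i+2 i = trans (ℙ.+-homo-+ (4 ℕ.* i) 2) (cong (ℙ._+ 0ℙ) (ℙ.*-homo-* 4 i))

  parity-Q : ∀ x y z w → parity (Q (x , y , z , w)) ≡ parity x ℙ.+ parity y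
  parity-Q x y z w = begin
    parity (Q (x , y , z , w))
      ≡⟨ parity-diagonal-square a (3 ℕ.* a) c d x y z w ⟩
    (ℕ.parity a ℙ.* parity x) ℙ.+ (ℕ.parity (3 ℕ.* a) ℙ.* parity y)
      ℙ.+ (ℕ.parity c ℙ.* parity z) ℙ.+ (ℕ.parity d ℙ.* parity w)
      ≡⟨ cong₂ (λ p q → (p ℙ.* parity x) ℙ.+ (q ℙ.* parity y) ℙ.+ (ℕ.parity c ℙ.* parity z) ℙ.+ (ℕ.parity d ℙ.* parity w))
               a-odd (trans (ℙ.*-homo-* 3 a) a-odd) ⟩
    parity x ℙ.+ parity y ℙ.+ (ℕ.parity c ℙ.* parity z) ℙ.+ (ℕ.parity d ℙ.* parity w)
      ≡⟨ cong₂ (λ p q → parity x ℙ.+ parity y ℙ.+ (p ℙ.* parity z) ℙ.+ (q ℙ.* parity w)) (parity-4i+2 k) (parity-4i+2 m) ⟩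
    parity x ℙ.+ parity y ℙ.+ 0ℙ ℙ.+ 0ℙ
      ≡⟨ trans (ℙ.+-identityʳ _) (ℙ.+-identityʳ _) ⟩
    parity x ℙ.+ parity y ∎
    where open ≡-Reasoning

  parity-x≡y : ∀ {v} x y z w → ℕ.parity v ≡ 0ℙ → Q (x , y , z , w) ≡ + v → parity x ≡ parity y
  parity-x≡y x y z w v-even eq = +≡0ℙ⇒≡ (trans (sym (parity-Q x y z w)) (trans (cong parity eq) v-even))

  solution-sheared : ∀ {v} p → ℕ.parity v ≡ 0ℙ → Q p ≡ + v → ∃ λ q → shear q ≡ p
  solution-sheared (x , y , z , w) v-even eq with same-parity⇒double {x} {y} (parity-x≡y x y z w v-even eq)
  ... | j , x≡y+2j = (j , y , z , w) , cong (_, y , z , w) (sym x≡y+2j)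

  pos-4i+2 : ∀ i → + (4 ℕ.* i ℕ.+ 2) ≡ + 4 * + i + + 2
  pos-4i+2 i = trans (ℤ.pos-+ (4 ℕ.* i) 2) (cong (_+ + 2) (ℤ.pos-* 4 i))

  Q-shear : ∀ j y z w → Q (shear (j , y , z , w)) ≡ + 4 * (+ a * eisenstein j y) + (+ 4 * K + + 2) * square z + (+ 4 * M + + 2) * square w
  Q-shear j y z w = trans (diagonal-shear a c d j y z w)
    (cong₂ (λ C D → + 4 * (+ a * eisenstein j y) + C * square z + D * square w) (pos-4i+2 k) (pos-4i+2 m))

  half-form : ℤ → ℤ → ℤ → ℤ → ℤ
  half-form j y z w = + 2 * (+ a * eisenstein j y) + ((+ 2 * K + + 1) * square z + (+ 2 * M + + 1) * square w)

  Q-shear≡2*half-form : ∀ j y z w → Q (shear (j , y , z , w)) ≡ + 2 * half-form j y z w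
  Q-shear≡2*half-form j y z w = trans (Q-shear j y z w) (halve (+ a * eisenstein j y) K M (square z) (square w))
    where halve : ∀ E C D Z W → + 4 * E + (+ 4 * C + + 2) * Z + (+ 4 * D + + 2) * W
                                ≡ + 2 * (+ 2 * E + ((+ 2 * C + + 1) * Z + (+ 2 * D + + 1) * W))
          halve = solve-∀

  parity-half-form : ∀ j y z w → parity (half-form j y z w) ≡ parity z ℙ.+ parity w
  parity-half-form j y z w = begin
    parity (half-form j y z w)
      ≡⟨ parity-+ (+ 2 * (+ a * eisenstein j y)) odd-part ⟩
    parity (+ 2 * (+ a * eisenstein j y)) ℙ.+ parity odd-part
      ≡⟨ cong (ℙ._+ parity odd-part) (parity-double (+ a * eisenstein j y)) ⟩
    parity odd-part
      ≡⟨ parity-+ ((+ 2 * K + + 1) * square z) ((+ 2 * M + + 1) * square w) ⟩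
    parity ((+ 2 * K + + 1) * square z) ℙ.+ parity ((+ 2 * M + + 1) * square w)
      ≡⟨ cong₂ ℙ._+_ (trans (parity-odd-multiple K (square z)) (parity-square z))
                     (trans (parity-odd-multiple M (square w)) (parity-square w)) ⟩
    parity z ℙ.+ parity w ∎
    where open ≡-Reasoning
          odd-part = (+ 2 * K + + 1) * square z + (+ 2 * M + + 1) * square w

  parity-z≡w : ∀ j y z w → Q (shear (j , y , z , w)) ≡ + target → parity z ≡ parity w
  parity-z≡w j y z w eq = +≡0ℙ⇒≡ (begin
    parity z ℙ.+ parity w       ≡⟨ parity-half-form j y z w ⟨
    parity (half-form j y z w)  ≡⟨ cong parity half-form≡ ⟩
    ℕ.parity (2 ℕ.* quarter)    ≡⟨ ℙ.*-homo-* 2 quarter ⟩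
    0ℙ                          ∎)
    where
    open ≡-Reasoning
    +target≡2*2quarter : + target ≡ + 2 * + (2 ℕ.* quarter)
    +target≡2*2quarter = trans (cong +_ (trans target≡4*quarter (ℕP.*-assoc 2 2 quarter))) (ℤ.pos-* 2 (2 ℕ.* quarter))
    half-form≡ : half-form j y z w ≡ + (2 ℕ.* quarter)
    half-form≡ = 2*-injective (trans (sym (Q-shear≡2*half-form j y z w)) (trans eq +target≡2*2quarter))

  quarter-form : ℤ → ℤ → ℤ → ℤ → ℤ
  quarter-form j y z l = + a * eisenstein j y + (K + M + + 1) * square z + + 2 * ((+ 2 * M + + 1) * (l * z + l * l))

  Q-shear≡4*quarter-form : ∀ j y z l → Q (shear (j , y , z , z + + 2 * l)) ≡ + 4 * quarter-form j y z l
  Q-shear≡4*quarter-form j y z l = trans (Q-shear j y z (z + + 2 * l)) (expand (+ a * eisenstein j y) K M z l)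
    where expand : ∀ E C D z l →
            + 4 * E + (+ 4 * C + + 2) * (z * z) + (+ 4 * D + + 2) * ((z + + 2 * l) * (z + + 2 * l))
            ≡ + 4 * (E + (C + D + + 1) * (z * z) + + 2 * ((+ 2 * D + + 1) * (l * z + l * l)))
          expand = solve-∀

  parity-quarter-form : ∀ j y z l → parity (quarter-form j y z l) ≡ parity (eisenstein j y) ℙ.+ parity z
  parity-quarter-form j y z l = begin
    parity (quarter-form j y z l)
      ≡⟨ parity-+ (+ a * eisenstein j y + (K + M + + 1) * square z) (+ 2 * rest) ⟩
    parity (+ a * eisenstein j y + (K + M + + 1) * square z) ℙ.+ parity (+ 2 * rest)
      ≡⟨ cong₂ ℙ._+_ (parity-+ (+ a * eisenstein j y) ((K + M + + 1) * square z)) (parity-double rest) ⟩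
    parity (+ a * eisenstein j y) ℙ.+ parity ((K + M + + 1) * square z) ℙ.+ 0ℙ
      ≡⟨ cong₂ (λ p q → p ℙ.+ q ℙ.+ 0ℙ) (parity-* (+ a) (eisenstein j y))
           (trans (parity-* (K + M + + 1) (square z))
                  (cong₂ ℙ._*_ (trans (parity-+ (K + M) (+ 1)) (cong (ℙ._+ 1ℙ) (parity-+ K M))) (parity-square z))) ⟩
    (ℕ.parity a ℙ.* parity (eisenstein j y)) ℙ.+ ((ℕ.parity k ℙ.+ ℕ.parity m ℙ.+ 1ℙ) ℙ.* parity z) ℙ.+ 0ℙ
      ≡⟨ cong₂ (λ p q → (p ℙ.* parity (eisenstein j y)) ℙ.+ ((q ℙ.+ ℕ.parity m ℙ.+ 1ℙ) ℙ.* parity z) ℙ.+ 0ℙ)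
               a-odd k≈m ⟩
    parity (eisenstein j y) ℙ.+ ((ℕ.parity m ℙ.+ ℕ.parity m ℙ.+ 1ℙ) ℙ.* parity z) ℙ.+ 0ℙ
      ≡⟨ simplify (parity (eisenstein j y)) (parity z) (ℕ.parity m) ⟩
    parity (eisenstein j y) ℙ.+ parity z ∎
    where
    open ≡-Reasoning
    rest = (+ 2 * M + + 1) * (l * z + l * l)
    simplify : ∀ e z p → e ℙ.+ ((p ℙ.+ p ℙ.+ 1ℙ) ℙ.* z) ℙ.+ 0ℙ ≡ e ℙ.+ z
    simplify e z 0ℙ = ℙ.+-identityʳ (e ℙ.+ z)
    simplify e z 1ℙ = ℙ.+-identityʳ (e ℙ.+ z)

  parity-z≡eisenstein′ : ∀ j y z l → Q (shear (j , y , z , z + + 2 * l)) ≡ + target → parity z ≡ parity (eisenstein j y)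
  parity-z≡eisenstein′ j y z l eq = sym (+≡0ℙ⇒≡ (begin
    parity (eisenstein j y) ℙ.+ parity z  ≡⟨ parity-quarter-form j y z l ⟨
    parity (quarter-form j y z l)         ≡⟨ cong parity quarter-form≡ ⟩
    ℕ.parity quarter                      ≡⟨ parity-quarter ⟩
    0ℙ                                    ∎))
    where
    open ≡-Reasoning
    quarter-form≡ : quarter-form j y z l ≡ + quarter
    quarter-form≡ = ℤ.*-cancelˡ-≡ (+ 4) (quarter-form j y z l) (+ quarter)
                      (trans (sym (Q-shear≡4*quarter-form j y z l)) (trans eq +target≡4*quarter))

  parity-z≡eisenstein : ∀ j y z w → Q (shear (j , y , z , w)) ≡ + target → parity z ≡ parity (eisenstein j y)
  parity-z≡eisenstein j y z w eq =
    let l , w≡z+2l = same-parity⇒double {w} {z} (sym (parity-z≡w j y z w eq))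
    in  parity-z≡eisenstein′ j y z l (subst (λ w → Q (shear (j , y , z , w)) ≡ + target) w≡z+2l eq)

  solutions : ℕ → P4 → ℕ
  solutions v p = 𝟙 (Q p ℤ.≟ + v)

  sheared : ℕ → P4 → ℕ
  sheared v q = solutions v (shear q)

  solutions-support : ∀ {v} p → solutions v p ≢ 0 → p ∈ box v
  solutions-support p ≢0 = InBox⇒∈box p (solution-InBox p (𝟙≢0 (Q p ℤ.≟ _) ≢0))

  sheared-support : ∀ {v} q → sheared v q ≢ 0 → q ∈ box v
  sheared-support q ≢0 = InBox⇒∈box q (InBox-shear q (solution-InBox (shear q) (𝟙≢0 (Q (shear q) ℤ.≟ _) ≢0)))

  sum-shear : ∀ v → ℕ.parity v ≡ 0ℙ → sumOver (box v) (solutions v) ≡ sumOver (box v) (sheared v)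
  sum-shear v v-even = sumOver-reindex shear shear-injective (box-unique v) (box-unique v) (λ _ → refl)
    (λ {p} → solutions-support p) (λ {q} → sheared-support q)
    (λ {p} ≢0 → solution-sheared p v-even (𝟙≢0 (Q p ℤ.≟ _) ≢0))

  Class : Set
  Class = Parity × Parity

  class : P4 → Class
  class (j , y , _ , _) = parity j , parity y

  is : Class → Class → Bool
  is c c′ = ⌊ ≡-dec ℙ._≟_ ℙ._≟_ c′ c ⌋

  is-true : ∀ c c′ → is c c′ ≡ true → c′ ≡ c
  is-true c c′ = ⌊⌋-true (≡-dec ℙ._≟_ ℙ._≟_ c′ c)

  y-odd : Class → Bool
  y-odd (_ , s) = ⌊ s ℙ.≟ 1ℙ ⌋

  inClass : (Class → Bool) → P4 → ℕ
  inClass S = restrict (S ∘ class) (sheared target)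

  inClass-solution : ∀ S q → inClass S q ≢ 0 → S (class q) ≡ true × Q (shear q) ≡ + target
  inClass-solution S q ≢0 =
    let S-true , sheared≢0 = restrict-≢0 (S ∘ class) (sheared target) q ≢0
    in  S-true , 𝟙≢0 (Q (shear q) ℤ.≟ + target) sheared≢0

  inClass-support : ∀ S q → inClass S q ≢ 0 → q ∈ box target
  inClass-support S q ≢0 = sheared-support q (proj₂ (restrict-≢0 (S ∘ class) (sheared target) q ≢0))

  sheared-split : ∀ q → sheared target q ≡ inClass (is (0ℙ , 0ℙ)) q ℕ.+ inClass (is (1ℙ , 0ℙ)) q ℕ.+ inClass y-odd q
  sheared-split q = split (class q) (sheared target q)
    where split : ∀ c s → s ≡ (if is (0ℙ , 0ℙ) c then s else 0) ℕ.+ (if is (1ℙ , 0ℙ) c then s else 0) ℕ.+ (if y-odd c then s else 0)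
          split (0ℙ , 0ℙ) s = sym (trans (ℕP.+-identityʳ (s ℕ.+ 0)) (ℕP.+-identityʳ s))
          split (1ℙ , 0ℙ) s = sym (ℕP.+-identityʳ s)
          split (0ℙ , 1ℙ) s = refl
          split (1ℙ , 1ℙ) s = refl

  y-odd-split : ∀ q → inClass y-odd q ≡ inClass (is (0ℙ , 1ℙ)) q ℕ.+ inClass (is (1ℙ , 1ℙ)) q
  y-odd-split q = split (class q) (sheared target q)
    where split : ∀ c s → (if y-odd c then s else 0) ≡ (if is (0ℙ , 1ℙ) c then s else 0) ℕ.+ (if is (1ℙ , 1ℙ) c then s else 0)
          split (0ℙ , 0ℙ) s = refl
          split (1ℙ , 0ℙ) s = refl
          split (0ℙ , 1ℙ) s = sym (ℕP.+-identityʳ s)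
          split (1ℙ , 1ℙ) s = refl

  sheared-double : ∀ q → sheared target (double q) ≡ sheared quarter q
  sheared-double q = 𝟙-⇔ (Q (shear (double q)) ℤ.≟ + target) (Q (shear q) ℤ.≟ + quarter) (mk⇔
    (λ eq → ℤ.*-cancelˡ-≡ (+ 4) _ _ (trans (sym Q-shear-double) (trans eq +target≡4*quarter)))
    (λ eq → trans Q-shear-double (trans (cong (+ 4 *_) eq) (sym +target≡4*quarter))))
    where Q-shear-double : Q (shear (double q)) ≡ + 4 * Q (shear q)
          Q-shear-double = trans (cong Q (shear-double q)) (diagonal-double a (3 ℕ.* a) c d (shear q))

  class-double : ∀ q → class (double q) ≡ (0ℙ , 0ℙ)
  class-double (j , y , _ , _) = cong₂ _,_ (parity-double j) (parity-double y)

  even-class-doubled : ∀ q → inClass (is (0ℙ , 0ℙ)) q ≢ 0 → ∃ λ q′ → double q′ ≡ q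
  even-class-doubled q@(j , y , z , w) ≢0 =
    let class-even , eq = inClass-solution (is (0ℙ , 0ℙ)) q ≢0
        j-even = cong proj₁ (is-true (0ℙ , 0ℙ) (class q) class-even)
        y-even = cong proj₂ (is-true (0ℙ , 0ℙ) (class q) class-even)
        z-even = trans (parity-z≡eisenstein j y z w eq)
                   (trans (parity-eisenstein j y) (cong₂ (λ p r → (p ℙ.* p) ℙ.+ (p ℙ.* r) ℙ.+ (r ℙ.* r)) j-even y-even))
    in  even⇒doubled j y z w j-even y-even z-even (trans (sym (parity-z≡w j y z w eq)) z-even)

  sum-double : sumOver (box target) (inClass (is (0ℙ , 0ℙ))) ≡ sumOver (box quarter) (sheared quarter)
  sum-double = sumOver-reindex double double-injective (box-unique quarter) (box-unique target)
    (λ q → cong₂ (λ c s → if is (0ℙ , 0ℙ) c then s else 0) (class-double q) (sheared-double q))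
    (λ {q} → inClass-support (is (0ℙ , 0ℙ)) q) (λ {q} → sheared-support q) (λ {q} → even-class-doubled q)

  t-solutions : P4 → ℕ
  t-solutions p = 𝟙 (diagonal tri a (3 ℕ.* a) c d p ℤ.≟ + n)

  t-solutions-support : ∀ p → t-solutions p ≢ 0 → p ∈ box (ℕ.suc n)
  t-solutions-support p ≢0 = InBox⇒∈box p
    (diagonal-InBox tri-bound 1≤a 1≤3a (1≤4i+2 k) (1≤4i+2 m) p
      (𝟙≢0 (diagonal tri a (3 ℕ.* a) c d p ℤ.≟ + n) ≢0))

  +target≡8n+[a+b+c+d] : + target ≡ + 8 * + n + + (a ℕ.+ 3 ℕ.* a ℕ.+ c ℕ.+ d)
  +target≡8n+[a+b+c+d] = trans (cong +_ (identity n m k a))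
    (trans (ℤ.pos-+ (8 ℕ.* n) (a ℕ.+ 3 ℕ.* a ℕ.+ c ℕ.+ d)) (cong (_+ + (a ℕ.+ 3 ℕ.* a ℕ.+ c ℕ.+ d)) (ℤ.pos-* 8 n)))
    where identity : ∀ n m k a → 8 ℕ.* n ℕ.+ 4 ℕ.* m ℕ.+ 4 ℕ.* k ℕ.+ 4 ℕ.* a ℕ.+ 4
                               ≡ 8 ℕ.* n ℕ.+ (a ℕ.+ 3 ℕ.* a ℕ.+ (4 ℕ.* k ℕ.+ 2) ℕ.+ (4 ℕ.* m ℕ.+ 2))
          identity = ℕ-Solver.solve-∀

  sheared-oddLift : ∀ p → sheared target (shearedOddLift p) ≡ t-solutions p
  sheared-oddLift p = trans (cong (λ i → 𝟙 (Q i ℤ.≟ + target)) (shear-shearedOddLift p))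
    (𝟙-⇔ (Q (oddLift p) ℤ.≟ + target) (diagonal tri a (3 ℕ.* a) c d p ℤ.≟ + n) (mk⇔
      (λ eq → cancel (trans (sym (diagonal-oddLift a (3 ℕ.* a) c d p)) (trans eq +target≡8n+[a+b+c+d])))
      (λ eq → trans (diagonal-oddLift a (3 ℕ.* a) c d p)
                    (trans (cong (λ i → + 8 * i + + (a ℕ.+ 3 ℕ.* a ℕ.+ c ℕ.+ d)) eq) (sym +target≡8n+[a+b+c+d])))))
    where cancel : ∀ {i j} → + 8 * i + + (a ℕ.+ 3 ℕ.* a ℕ.+ c ℕ.+ d) ≡ + 8 * j + + (a ℕ.+ 3 ℕ.* a ℕ.+ c ℕ.+ d) → i ≡ j
          cancel {i} {j} eq = ℤ.*-cancelˡ-≡ (+ 8) i j (∙-cancelʳ _ _ _ eq)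

  class-shearedOddLift : ∀ p → y-odd (class (shearedOddLift p)) ≡ true
  class-shearedOddLift (x , y , z , w) = cong (λ s → ⌊ s ℙ.≟ 1ℙ ⌋) (parity-odd y)

  odd-class-lifted : ∀ q → inClass y-odd q ≢ 0 → ∃ λ p → shearedOddLift p ≡ q
  odd-class-lifted q@(j , y , z , w) ≢0 =
    let y-odd-class , eq = inClass-solution y-odd q ≢0
        y-odd′ = ⌊⌋-true (parity y ℙ.≟ 1ℙ) y-odd-class
        z-odd = trans (parity-z≡eisenstein j y z w eq)
                  (trans (parity-eisenstein j y)
                    (trans (cong (λ r → (parity j ℙ.* parity j) ℙ.+ (parity j ℙ.* r) ℙ.+ (r ℙ.* r)) y-odd′) (norm-odd (parity j))))
    in  odd⇒shearedOddLift j y z w y-odd′ z-odd (trans (sym (parity-z≡w j y z w eq)) z-odd)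
    where norm-odd : ∀ p → (p ℙ.* p) ℙ.+ (p ℙ.* 1ℙ) ℙ.+ (1ℙ ℙ.* 1ℙ) ≡ 1ℙ
          norm-odd 0ℙ = refl
          norm-odd 1ℙ = refl

  sum-oddLift : sumOver (box target) (inClass y-odd) ≡ sumOver (box (ℕ.suc n)) t-solutions
  sum-oddLift = sumOver-reindex shearedOddLift shearedOddLift-injective (box-unique (ℕ.suc n)) (box-unique target)
    (λ p → cong₂ (λ b s → if b then s else 0) (class-shearedOddLift p) (sheared-oddLift p))
    (λ {q} → inClass-support y-odd q) (λ {p} → t-solutions-support p) (λ {q} → odd-class-lifted q)

  rotateClass : Class → Class
  rotateClass (r , s) = s , r ℙ.+ s

  class-rotate : ∀ q → class (rotate q) ≡ rotateClass (class q)
  class-rotate (j , y , _ , _) = cong (parity y ,_) (trans (parity-neg (j + y)) (parity-+ j y))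

  sheared-rotate : ∀ q → sheared target (rotate q) ≡ sheared target q
  sheared-rotate q = cong (λ i → 𝟙 (i ℤ.≟ + target)) (diagonal-shear-rotate a c d q)

  sum-rotate : ∀ S → sumOver (box target) (inClass S) ≡ sumOver (box target) (inClass (S ∘ rotateClass))
  sum-rotate S = sumOver-reindex rotate rotate-injective (box-unique target) (box-unique target)
    (λ q → cong₂ (λ c s → if S c then s else 0) (class-rotate q) (sheared-rotate q))
    (λ {q} → inClass-support S q) (λ {q} → inClass-support (S ∘ rotateClass) q)
    (λ {q} _ → rotate (rotate q) , rotate³ q)

  sum-inClass-cong : ∀ {S T} → (∀ c → S c ≡ T c) → sumOver (box target) (inClass S) ≡ sumOver (box target) (inClass T)
  sum-inClass-cong S≗T = sumOver-cong (box target) (λ q → cong (λ b → if b then sheared target q else 0) (S≗T (class q)))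

  W : ℕ
  W = sumOver (box target) (inClass (is (1ℙ , 0ℙ)))

  sum-01≡W : sumOver (box target) (inClass (is (0ℙ , 1ℙ))) ≡ W
  sum-01≡W = trans (sum-rotate (is (0ℙ , 1ℙ))) (sum-inClass-cong {is (0ℙ , 1ℙ) ∘ rotateClass} {is (1ℙ , 0ℙ)} rotated)
    where rotated : ∀ c → is (0ℙ , 1ℙ) (rotateClass c) ≡ is (1ℙ , 0ℙ) c
          rotated (0ℙ , 0ℙ) = refl
          rotated (0ℙ , 1ℙ) = refl
          rotated (1ℙ , 0ℙ) = refl
          rotated (1ℙ , 1ℙ) = refl

  sum-11≡W : sumOver (box target) (inClass (is (1ℙ , 1ℙ))) ≡ W
  sum-11≡W = trans (sum-rotate (is (1ℙ , 1ℙ)))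
                   (trans (sum-inClass-cong {is (1ℙ , 1ℙ) ∘ rotateClass} {is (0ℙ , 1ℙ)} rotated) sum-01≡W)
    where rotated : ∀ c → is (1ℙ , 1ℙ) (rotateClass c) ≡ is (0ℙ , 1ℙ) c
          rotated (0ℙ , 0ℙ) = refl
          rotated (0ℙ , 1ℙ) = refl
          rotated (1ℙ , 0ℙ) = refl
          rotated (1ℙ , 1ℙ) = refl

  N-target≡N-quarter+W+t : N a (3 ℕ.* a) c d target ≡ N a (3 ℕ.* a) c d quarter ℕ.+ W ℕ.+ t a (3 ℕ.* a) c d n
  N-target≡N-quarter+W+t = begin
    N a (3 ℕ.* a) c d target
      ≡⟨ count4≡sumOver-box target (λ x y z w → Q (x , y , z , w)) (+ target) ⟩
    sumOver (box target) (solutions target)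
      ≡⟨ sum-shear target parity-target ⟩
    sumOver (box target) (sheared target)
      ≡⟨ sumOver-cong (box target) sheared-split ⟩
    sumOver (box target) (λ q → inClass (is (0ℙ , 0ℙ)) q ℕ.+ inClass (is (1ℙ , 0ℙ)) q ℕ.+ inClass y-odd q)
      ≡⟨ sumOver-+ (box target) (λ q → inClass (is (0ℙ , 0ℙ)) q ℕ.+ inClass (is (1ℙ , 0ℙ)) q) (inClass y-odd) ⟩
    sumOver (box target) (λ q → inClass (is (0ℙ , 0ℙ)) q ℕ.+ inClass (is (1ℙ , 0ℙ)) q) ℕ.+ sumOver (box target) (inClass y-odd)
      ≡⟨ cong₂ ℕ._+_ (sumOver-+ (box target) (inClass (is (0ℙ , 0ℙ))) (inClass (is (1ℙ , 0ℙ)))) sum-oddLift ⟩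
    sumOver (box target) (inClass (is (0ℙ , 0ℙ))) ℕ.+ W ℕ.+ sumOver (box (ℕ.suc n)) t-solutions
      ≡⟨ cong₂ (λ i j → i ℕ.+ W ℕ.+ j) (trans sum-double (sym (sum-shear quarter parity-quarter))) (sym t≡sum) ⟩
    sumOver (box quarter) (solutions quarter) ℕ.+ W ℕ.+ t a (3 ℕ.* a) c d n
      ≡⟨ cong (λ i → i ℕ.+ W ℕ.+ t a (3 ℕ.* a) c d n) (count4≡sumOver-box quarter (λ x y z w → Q (x , y , z , w)) (+ quarter)) ⟨
    N a (3 ℕ.* a) c d quarter ℕ.+ W ℕ.+ t a (3 ℕ.* a) c d n ∎
    where
    open ≡-Reasoning
    t≡sum : t a (3 ℕ.* a) c d n ≡ sumOver (box (ℕ.suc n)) t-solutions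
    t≡sum = count4≡sumOver-box (ℕ.suc n) (λ x y z w → diagonal tri a (3 ℕ.* a) c d (x , y , z , w)) (+ n)

  t≡W+W : t a (3 ℕ.* a) c d n ≡ W ℕ.+ W
  t≡W+W = begin
    t a (3 ℕ.* a) c d n
      ≡⟨ count4≡sumOver-box (ℕ.suc n) (λ x y z w → diagonal tri a (3 ℕ.* a) c d (x , y , z , w)) (+ n) ⟩
    sumOver (box (ℕ.suc n)) t-solutions
      ≡⟨ sum-oddLift ⟨
    sumOver (box target) (inClass y-odd)
      ≡⟨ sumOver-cong (box target) y-odd-split ⟩
    sumOver (box target) (λ q → inClass (is (0ℙ , 1ℙ)) q ℕ.+ inClass (is (1ℙ , 1ℙ)) q)
      ≡⟨ sumOver-+ (box target) (inClass (is (0ℙ , 1ℙ))) (inClass (is (1ℙ , 1ℙ))) ⟩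
    sumOver (box target) (inClass (is (0ℙ , 1ℙ))) ℕ.+ sumOver (box target) (inClass (is (1ℙ , 1ℙ)))
      ≡⟨ cong₂ ℕ._+_ sum-01≡W sum-11≡W ⟩
    W ℕ.+ W ∎
    where open ≡-Reasoning

  three-halves : ∀ {u v s w : ℕ} → u ≡ v ℕ.+ w ℕ.+ s → s ≡ w ℕ.+ w → + 3 * + s ≡ + 2 * (+ u - + v)
  three-halves {v = v} {w = w} refl refl = begin
    + 3 * + (w ℕ.+ w)                        ≡⟨ cong (+ 3 *_) (ℤ.pos-+ w w) ⟩
    + 3 * (+ w + + w)                        ≡⟨ identity (+ v) (+ w) ⟩
    + 2 * (+ v + + w + (+ w + + w) - + v)    ≡⟨ cong (λ i → + 2 * (i - + v)) pos-sum ⟨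
    + 2 * (+ (v ℕ.+ w ℕ.+ (w ℕ.+ w)) - + v)  ∎
    where
    open ≡-Reasoning
    identity : ∀ v w → + 3 * (w + w) ≡ + 2 * (v + w + (w + w) - v)
    identity = solve-∀
    pos-sum : + (v ℕ.+ w ℕ.+ (w ℕ.+ w)) ≡ + v + + w + (+ w + + w)
    pos-sum = trans (ℤ.pos-+ (v ℕ.+ w) (w ℕ.+ w)) (cong₂ _+_ (ℤ.pos-+ v w) (ℤ.pos-+ w w))

  counting-identity : + 3 * + t a (3 ℕ.* a) c d n ≡ + 2 * (+ N a (3 ℕ.* a) c d target - + N a (3 ℕ.* a) c d quarter)
  counting-identity = three-halves {v = N a (3 ℕ.* a) c d quarter} {w = W} N-target≡N-quarter+W+t t≡W+W

open import Data.Nat using (ℕ; _+_; _*_; _%_; _≥_)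
open import Data.Integer using (+_; _-_) renaming (_*_ to _*ℤ_)
open import Relation.Binary.PropositionalEquality using (_≡_)
open import Defs using (N; t)

theorem2p2 : (a k m n : ℕ) → a % 2 ≡ 1 → k % 2 ≡ m % 2 → n ≥ 1 →
    + 3 *ℤ + t a (3 * a) (4 * k + 2) (4 * m + 2) n
      ≡ + 2 *ℤ (+ N a (3 * a) (4 * k + 2) (4 * m + 2) (8 * n + 4 * m + 4 * k + 4 * a + 4)
               - + N a (3 * a) (4 * k + 2) (4 * m + 2) (2 * n + m + k + a + 1))
theorem2p2 a k m n a%2≡1 k%2≡m%2 _ =
  Counting.counting-identity a k m n (IntegerParity.parity-cong-%2 a 1 a%2≡1) (IntegerParity.parity-cong-%2 k m k%2≡m%2)
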